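{- For every integer $k\ge 3$ there exists an $(\mathcal{M},k)$-forcer $(G,v)$. Moreover, such a forcer exists with $G$ a planar graph.
   Context: Let $k\ge 3$. A $(k,1)$-decomposition of a graph $G$ is a pair $(F_k,M)$ of sets partitioning $E(G)$ such that $F_k$ spans a $k$-bounded linear forest (a forest whose components are paths with at most $k$ edges each) and $M$ is a matching. Given a graph $G$ and a vertex $v$ of degree $1$ in $G$, the pair $(G,v)$ is an $(\mathcal{M},k)$-forcer if (i) $G$ has a $(k,1)$-decomposition, and (ii) for every $(k,1)$-decomposition $(F_k,M)$ of $G$, the edge of $G$ containing $v$ belongs to $M$. -}

module Defs where

open import Data.Nat using (ℕ; suc; _≤_)
open import Data.Fin using (Fin)
open import Data.Bool using (Bool; true; false)
open import Data.Integer as ℤ using (ℤ; _-_; _*_; _⊓_; _⊔_; 0ℤ)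
open import Data.Product using (Σ; _×_; _,_; ∃)
open import Function.Definitions using (Injective)
open import Relation.Binary.PropositionalEquality using (_≡_)
open import Relation.Nullary using (¬_)

record Graph : Set where
  field
    n      : ℕ
    adj    : Fin n → Fin n → Bool
    sym    : ∀ x y → adj x y ≡ adj y x
    irrefl : ∀ x → adj x x ≡ false

open Graph public

Edge : (G : Graph) → Fin (n G) → Fin (n G) → Set
Edge G x y = adj G x y ≡ true

DegreeOne : (G : Graph) → Fin (n G) → Set
DegreeOne G v = Σ (Fin (n G)) λ u → Edge G v u × (∀ w → Edge G v w → w ≡ u)

record PathOfLength {N : ℕ} (E : Fin N → Fin N → Set) (m : ℕ) : Set where
  field
    vtx  : Fin (suc m) → Fin N
    inj  : Injective _≡_ _≡_ vtx
    step : ∀ (i : Fin m) → E (vtx (Data.Fin.inject₁ i)) (vtx (Data.Fin.suc i))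

-- A cycle of length m+1 ≥ 3: m+1 pairwise distinct vertices, consecutive
-- ones adjacent, and the last adjacent to the first.
record CycleOfLength {N : ℕ} (E : Fin N → Fin N → Set) (m : ℕ) : Set where
  field
    len≥ : 2 ≤ m
    path : PathOfLength E m
    close : E (PathOfLength.vtx path (Data.Fin.fromℕ m)) (PathOfLength.vtx path Data.Fin.zero)

-- E spans a k-bounded linear forest: a forest (no cycles) whose components
-- are paths (max degree ≤ 2) each having at most k edges (no path with
-- k+1 edges).
KBoundedLinearForest : ℕ → {N : ℕ} → (Fin N → Fin N → Set) → Set
KBoundedLinearForest k {N} E =
    (∀ m → ¬ CycleOfLength E m)
  × (∀ x y z w → E x y → E x z → E x w → (y ≡ z) ⊎' (y ≡ w) ⊎' (z ≡ w))
  × ¬ PathOfLength E (suc k)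
  where
    open import Data.Sum renaming (_⊎_ to _⊎'_)

-- (k,1)-decompositions: a partition of E(G) into F_k and M.  An edge xy
-- belongs to M iff inM x y ≡ true, and to F_k otherwise.

record Decomposition (k : ℕ) (G : Graph) : Set where
  field
    inM      : Fin (n G) → Fin (n G) → Bool
    inM-sym  : ∀ x y → inM x y ≡ inM y x
    matching : ∀ x y z → Edge G x y → Edge G x z →
               inM x y ≡ true → inM x z ≡ true → y ≡ z
    forest   : KBoundedLinearForest k (λ x y → Edge G x y × inM x y ≡ false)

open Decomposition public

IsForcer : (k : ℕ) (G : Graph) → Fin (n G) → Set
IsForcer k G v =
    DegreeOne G v
  × Decomposition k G
  × (∀ (D : Decomposition k G) → ∀ w → Edge G v w → inM D v w ≡ true)

-- Planarity, via straight-line drawings with integer coordinates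
-- (by Fáry's theorem every planar graph has one, so this is equivalent
-- to the topological notion).

Point : Set
Point = ℤ × ℤ

orient : Point → Point → Point → ℤ
orient (px , py) (qx , qy) (rx , ry) = ((qx - px) * (ry - py)) - ((qy - py) * (rx - px))

OnSegment : Point → Point → Point → Set
OnSegment p@(px , py) q@(qx , qy) r@(rx , ry) =
    orient p q r ≡ 0ℤ
  × ((px ⊓ qx) ℤ.≤ rx) × (rx ℤ.≤ (px ⊔ qx))
  × ((py ⊓ qy) ℤ.≤ ry) × (ry ℤ.≤ (py ⊔ qy))

ProperCross : Point → Point → Point → Point → Set
ProperCross a b c d =
    ((orient a b c * orient a b d) ℤ.< 0ℤ)
  × ((orient c d a * orient c d b) ℤ.< 0ℤ)

record StraightLineDrawing (G : Graph) : Set where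
  field
    pos     : Fin (n G) → Point
    pos-inj : Injective _≡_ _≡_ pos
    noVertexOnEdge : ∀ x y z → Edge G x y → ¬ z ≡ x → ¬ z ≡ y →
                     ¬ OnSegment (pos x) (pos y) (pos z)
    noCrossing : ∀ a b c d → Edge G a b → Edge G c d →
                 ¬ a ≡ c → ¬ a ≡ d → ¬ b ≡ c → ¬ b ≡ d →
                 ¬ ProperCross (pos a) (pos b) (pos c) (pos d)

Planar : Graph → Set
Planar G = StraightLineDrawing G

module Submission where

-- For every k ≥ 3 an explicit planar gadget with a pendant vertex works, and a single gadget works
-- for all k ≥ 8. A (k,1)-decomposition of a gadget is given by a matching M whose complement F
-- only joins consecutively numbered vertices within blocks of at most k + 1 vertices; such an F is
-- a k-bounded linear forest since every F-path is monotone in the numbering. For forcing, every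
-- assignment of the edges to M or F that puts the pendant edge into F contains two M-edges at a
-- vertex, three F-edges at a vertex, an F-cycle or an F-path with k + 1 edges; this is verified by
-- a search that abandons a partial assignment as soon as it contains such a configuration. For
-- k ≥ 8 no paths are needed: the stem is joined to one tip of each of two diamonds (K₄ minus an
-- edge); the central edge of a diamond is not in M (else the other four edges form an F-cycle), so
-- each triangle has an M-edge at its tip, which puts both edges from the stem to the diamonds into F
-- and leaves the pendant edge to M.

open import Defs hiding (sym)
open import Agda.Builtin.FromNat using (Number; fromNat)
open import Data.Bool using (Bool; true; false; not; _∧_; _∨_; T; if_then_else_)
import Data.Bool as Bool
open import Data.Bool.ListAction using (any)
open import Data.Bool.Properties using (∧-comm; ∨-comm; T-∧; T-∨; T-≡)
open import Data.Empty using (⊥-elim)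
open import Data.Unit using (⊤; tt)
open import Data.Fin using (Fin; zero; suc; toℕ; fromℕ; inject₁)
open import Data.Fin.Properties using (_≟_; toℕ-injective; all?)
import Data.Fin.Properties as Fin
import Data.Fin.Literals as Fin
import Data.Integer as ℤ
open import Data.Integer using (0ℤ; _⊓_; _⊔_)
import Data.Integer.Literals as ℤ
import Data.Nat.Literals as ℕ
open import Data.List using (List; []; _∷_; map; allFin; filterᵇ; concatMap; _++_)
open import Data.List.Relation.Unary.All as All using (All; []; _∷_)
open import Data.List.Relation.Unary.Any using (satisfied)
open import Data.List.Relation.Unary.Any.Properties using (any⁻)
open import Data.Nat using (ℕ; zero; suc; _+_; _≤_; z≤n; s≤s)
import Data.Nat as ℕ
open import Data.Nat.Properties
  using ( suc-injective; +-identityʳ; +-suc; +-comm; +-cancelˡ-≡; +-cancelˡ-≤; m≢1+m+n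
        ; ≤-refl; ≤-trans; m≤m+n; 1+n≰n)
open import Data.Product using (Σ; _×_; _,_; proj₁; proj₂)
open import Data.Product.Properties using (≡-dec)
open import Data.Sum using (_⊎_; inj₁; inj₂)
open import Data.Vec using (Vec; []; _∷_; lookup)
open import Function using (_∘_; case_of_)
open import Function.Bundles using (Equivalence)
open import Function.Definitions using (Injective)
open import Relation.Binary.PropositionalEquality
open import Relation.Nullary using (¬_; Dec; yes; no)
open import Relation.Nullary.Decidable
  using (True; ⌊_⌋; toWitness; fromWitness; _→-dec_; _×-dec_; _⊎-dec_; ¬?)

instance
  finLiterals : ∀ {n} → Number (Fin n)
  finLiterals = Fin.number _

  naturalLiterals : Number ℕ
  naturalLiterals = ℕ.number

  integerLiterals : Number ℤ.ℤ
  integerLiterals = ℤ.number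

  trivialConstraint : ⊤
  trivialConstraint = tt

module ConsecutiveLabelling {N : ℕ} (E : Fin N → Fin N → Set) (ι : Fin N → ℕ)
  (ι-injective : Injective _≡_ _≡_ ι)
  (consecutive : ∀ {x y} → E x y → ι y ≡ suc (ι x) ⊎ ι x ≡ suc (ι y)) where

  open PathOfLength
  open CycleOfLength

  tail : ∀ {m} → PathOfLength E (suc m) → PathOfLength E m
  tail p = record { vtx = vtx p ∘ suc ; inj = Fin.suc-injective ∘ inj p ; step = step p ∘ suc }

  Ascending Descending : ∀ {m} → PathOfLength E m → Set
  Ascending p  = ∀ i → ι (vtx p (suc i)) ≡ suc (ι (vtx p (inject₁ i)))
  Descending p = ∀ i → ι (vtx p (inject₁ i)) ≡ suc (ι (vtx p (suc i)))

  no-backtrack : ∀ {m} (p : PathOfLength E (suc (suc m))) →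
                 ι (vtx p zero) ≢ ι (vtx p (suc (suc zero)))
  no-backtrack p eq with inj p (ι-injective eq)
  ... | ()

  monotone : ∀ {m} (p : PathOfLength E m) → Ascending p ⊎ Descending p
  monotone {zero} p = inj₁ λ ()
  monotone {suc zero} p with consecutive (step p zero)
  ... | inj₁ up   = inj₁ λ { zero → up }
  ... | inj₂ down = inj₂ λ { zero → down }
  monotone {suc (suc m)} p with consecutive (step p zero) | monotone (tail p)
  ... | inj₁ up   | inj₁ ups   = inj₁ λ { zero → up ; (suc i) → ups i }
  ... | inj₂ down | inj₂ downs = inj₂ λ { zero → down ; (suc i) → downs i }
  ... | inj₁ up   | inj₂ downs = ⊥-elim (no-backtrack p (suc-injective (trans (sym up) (downs zero))))
  ... | inj₂ down | inj₁ ups   = ⊥-elim (no-backtrack p (trans down (sym (ups zero))))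

  ascending-span : ∀ {m} (p : PathOfLength E m) → Ascending p →
                   ι (vtx p (fromℕ m)) ≡ ι (vtx p zero) + m
  ascending-span {zero}  p _  = sym (+-identityʳ _)
  ascending-span {suc m} p up = begin
    ι (vtx p (suc (fromℕ m)))  ≡⟨ ascending-span (tail p) (up ∘ suc) ⟩
    ι (vtx p (suc zero)) + m   ≡⟨ cong (_+ m) (up zero) ⟩
    suc (ι (vtx p zero)) + m   ≡⟨ sym (+-suc _ m) ⟩
    ι (vtx p zero) + suc m     ∎
    where open ≡-Reasoning

  descending-span : ∀ {m} (p : PathOfLength E m) → Descending p →
                    ι (vtx p zero) ≡ ι (vtx p (fromℕ m)) + m
  descending-span {zero}  p _    = sym (+-identityʳ _)
  descending-span {suc m} p down = begin
    ι (vtx p zero)                     ≡⟨ down zero ⟩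
    suc (ι (vtx p (suc zero)))         ≡⟨ cong suc (descending-span (tail p) (down ∘ suc)) ⟩
    suc (ι (vtx p (suc (fromℕ m))) + m) ≡⟨ sym (+-suc _ m) ⟩
    ι (vtx p (suc (fromℕ m))) + suc m  ∎
    where open ≡-Reasoning

  m+n≢1+m : ∀ a {m} → 2 ≤ m → a + m ≢ suc a
  m+n≢1+m a 2≤m eq = 1+n≰n (subst (2 ≤_) (+-cancelˡ-≡ a _ 1 (trans eq (+-comm 1 a))) 2≤m)

  acyclic : ∀ m → ¬ CycleOfLength E m
  acyclic m c with monotone (path c) | consecutive (close c)
  ... | inj₁ up   | inj₁ closing =
    m≢1+m+n _ (trans closing (cong suc (ascending-span (path c) up)))
  ... | inj₁ up   | inj₂ closing =
    m+n≢1+m _ (len≥ c) (trans (sym (ascending-span (path c) up)) closing)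
  ... | inj₂ down | inj₁ closing =
    m+n≢1+m _ (len≥ c) (trans (sym (descending-span (path c) down)) closing)
  ... | inj₂ down | inj₂ closing =
    m≢1+m+n _ (trans closing (cong suc (descending-span (path c) down)))

  degree≤2 : ∀ x y z w → E x y → E x z → E x w → y ≡ z ⊎ y ≡ w ⊎ z ≡ w
  degree≤2 x y z w exy exz exw with consecutive exy | consecutive exz | consecutive exw
  ... | inj₁ p | inj₁ q | _      = inj₁ (ι-injective (trans p (sym q)))
  ... | inj₂ p | inj₂ q | _      = inj₁ (ι-injective (suc-injective (trans (sym p) q)))
  ... | inj₁ p | inj₂ _ | inj₁ r = inj₂ (inj₁ (ι-injective (trans p (sym r))))
  ... | inj₂ p | inj₁ _ | inj₂ r = inj₂ (inj₁ (ι-injective (suc-injective (trans (sym p) r))))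
  ... | inj₁ _ | inj₂ q | inj₂ r = inj₂ (inj₂ (ι-injective (suc-injective (trans (sym q) r))))
  ... | inj₂ _ | inj₁ q | inj₁ r = inj₂ (inj₂ (ι-injective (trans q (sym r))))

  module _ (block : Fin N → ℕ) (block-E : ∀ {x y} → E x y → block x ≡ block y)
           (W : ℕ) (narrow : ∀ x y → block x ≡ block y → ι y ≤ ι x + W) where

    block-ends : ∀ {m} (p : PathOfLength E m) → block (vtx p zero) ≡ block (vtx p (fromℕ m))
    block-ends {zero}  p = refl
    block-ends {suc m} p = trans (block-E (step p zero)) (block-ends (tail p))

    length≤width : ∀ {m} → PathOfLength E m → m ≤ W
    length≤width {m} p with monotone p
    ... | inj₁ up   = +-cancelˡ-≤ (ι (vtx p zero)) m W
      (subst (_≤ ι (vtx p zero) + W) (ascending-span p up) (narrow _ _ (block-ends p)))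
    ... | inj₂ down = +-cancelˡ-≤ (ι (vtx p (fromℕ m))) m W
      (subst (_≤ ι (vtx p (fromℕ m)) + W) (descending-span p down)
             (narrow _ _ (sym (block-ends p))))

    linearForest : ∀ {k} → W ≤ k → KBoundedLinearForest k E
    linearForest W≤k = acyclic , degree≤2 , λ p → 1+n≰n (≤-trans (length≤width p) W≤k)

module _ {N : ℕ} where

  _==_ : Fin N → Fin N → Bool
  x == y = ⌊ x ≟ y ⌋

  ==-refl : ∀ x → (x == x) ≡ true
  ==-refl x = Equivalence.to T-≡ (fromWitness refl)

  ==-sound : ∀ {x y} → T (x == y) → x ≡ y
  ==-sound = toWitness

  ==-sym : ∀ x y → (x == y) ≡ (y == x)
  ==-sym x y with x ≟ y | y ≟ x
  ... | yes _   | yes _   = refl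
  ... | no  _   | no  _   = refl
  ... | yes x≡y | no  y≢x = ⊥-elim (y≢x (sym x≡y))
  ... | no  x≢y | yes y≡x = ⊥-elim (x≢y (sym y≡x))

  joins : Fin N × Fin N → Fin N → Fin N → Bool
  joins (a , b) x y = (x == a ∧ y == b) ∨ (x == b ∧ y == a)

  linked : List (Fin N × Fin N) → Fin N → Fin N → Bool
  linked es x y = any (λ e → joins e x y) es

  joins-sym : ∀ e x y → joins e x y ≡ joins e y x
  joins-sym (a , b) x y =
    trans (∨-comm (x == a ∧ y == b) _) (cong₂ _∨_ (∧-comm (x == b) _) (∧-comm (x == a) _))

  linked-sym : ∀ es x y → linked es x y ≡ linked es y x
  linked-sym []       x y = refl
  linked-sym (e ∷ es) x y = cong₂ _∨_ (joins-sym e x y) (linked-sym es x y)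

  joins-sound : ∀ {a b x y} → T (joins (a , b) x y) → (x ≡ a × y ≡ b) ⊎ (x ≡ b × y ≡ a)
  joins-sound {a} {b} {x} {y} h with Equivalence.to T-∨ h
  ... | inj₁ h₁ = let xa , yb = Equivalence.to T-∧ h₁ in inj₁ (==-sound xa , ==-sound yb)
  ... | inj₂ h₂ = let xb , ya = Equivalence.to T-∧ h₂ in inj₂ (==-sound xb , ==-sound ya)

  joins-self : ∀ a b → T (joins (a , b) a b)
  joins-self a b rewrite ==-refl a | ==-refl b = _

  listed-linked : ∀ (es : List (Fin N × Fin N)) → All (λ (a , b) → T (linked es a b)) es
  listed-linked []             = []
  listed-linked ((a , b) ∷ es) =
    Equivalence.from T-∨ (inj₁ (joins-self a b))
      ∷ All.map (λ h → Equivalence.from T-∨ (inj₂ h)) (listed-linked es)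

  BothWays : (Fin N → Fin N → Set) → Fin N × Fin N → Set
  BothWays P (a , b) = P a b × P b a

  bothWays? : ∀ {P} → (∀ x y → Dec (P x y)) → ∀ e → Dec (BothWays P e)
  bothWays? P? (a , b) = P? a b ×-dec P? b a

  edgewise : (P : Fin N → Fin N → Set) {es : List (Fin N × Fin N)} →
             All (BothWays P) es → ∀ {x y} → T (linked es x y) → P x y
  edgewise P {(a , b) ∷ _} ((pab , pba) ∷ ps) {x} {y} h with Equivalence.to T-∨ h
  ... | inj₂ h′ = edgewise P ps h′
  ... | inj₁ j with joins-sound {a} {b} {x} {y} j
  ...   | inj₁ (refl , refl) = pab
  ...   | inj₂ (refl , refl) = pba

-- Loops in the list are ignored, so the adjacency is irreflexive by construction.
fromEdges : ∀ {N} → List (Fin N × Fin N) → Graph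
fromEdges {N} es = record
  { n      = N
  ; adj    = λ x y → not (x == y) ∧ linked es x y
  ; sym    = λ x y → cong₂ (λ b c → not b ∧ c) (==-sym x y) (linked-sym es x y)
  ; irrefl = λ x → cong (λ b → not b ∧ linked es x x) (==-refl x)
  }

module _ {N : ℕ} (es : List (Fin N × Fin N)) where

  edge-linked : ∀ {x y} → Edge (fromEdges es) x y → T (linked es x y)
  edge-linked h = proj₂ (Equivalence.to T-∧ (Equivalence.from T-≡ h))

  edge-intro : ∀ {x y} → T (not (x == y)) → T (linked es x y) → Edge (fromEdges es) x y
  edge-intro x≢y h = Equivalence.to T-≡ (Equivalence.from T-∧ (x≢y , h))

module _ (G : Graph) (partner : Fin (n G) → Fin (n G)) where

  partnered : Fin (n G) → Fin (n G) → Bool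
  partnered x y = partner x == y ∧ partner y == x

  Unpartnered : Fin (n G) → Fin (n G) → Set
  Unpartnered x y = Edge G x y × partnered x y ≡ false

  partnerDecomposition : ∀ {k} → KBoundedLinearForest k Unpartnered → Decomposition k G
  partnerDecomposition forest = record
    { inM      = partnered
    ; inM-sym  = λ x y → ∧-comm (partner x == y) _
    ; matching = λ x y z _ _ xy xz → trans (sym (partner-of xy)) (partner-of xz)
    ; forest   = forest
    }
    where
      partner-of : ∀ {x y} → partnered x y ≡ true → partner x ≡ y
      partner-of h = ==-sound (proj₁ (Equivalence.to T-∧ (Equivalence.from T-≡ h)))

module _ {N : ℕ} where

  Colouring : Set
  Colouring = List ((Fin N × Fin N) × Bool)

  colouredAs : Bool → Colouring → Fin N → Fin N → Bool
  colouredAs β []            x y = false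
  colouredAs β ((e , γ) ∷ c) x y =
    if joins e x y then ⌊ γ Bool.≟ β ⌋ else colouredAs β c x y

  hasColour : Bool → Colouring → Fin N → Fin N → Bool
  hasColour β c x y = not (x == y) ∧ colouredAs β c x y

  distinct : ∀ {m} → Vec (Fin N) m → Bool
  distinct cs = ⌊ all? (λ i → all? λ j → (lookup cs i ≟ lookup cs j) →-dec (i ≟ j)) ⌋

  freeWalk : ∀ {m} → Colouring → Vec (Fin N) (suc m) → Bool
  freeWalk c (x ∷ [])     = true
  freeWalk c (x ∷ y ∷ cs) = hasColour false c x y ∧ freeWalk c (y ∷ cs)

  data Obstruction (k : ℕ) : Set where
    matchedPair : (x y z : Fin N) → Obstruction k
    freeClaw    : (x y z w : Fin N) → Obstruction k
    freeCycle   : ∀ {m} → Vec (Fin N) (3 + m) → Obstruction k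
    freePath    : Vec (Fin N) (2 + k) → Obstruction k

  occursIn : ∀ {k} → Colouring → Obstruction k → Bool
  occursIn c (matchedPair x y z) =
    hasColour true c x y ∧ hasColour true c x z ∧ distinct (y ∷ z ∷ [])
  occursIn c (freeClaw x y z w) =
    hasColour false c x y ∧ hasColour false c x z ∧ hasColour false c x w ∧ distinct (y ∷ z ∷ w ∷ [])
  occursIn c (freeCycle cs) =
    freeWalk c cs ∧ hasColour false c (lookup cs (fromℕ _)) (lookup cs zero) ∧ distinct cs
  occursIn c (freePath cs) = freeWalk c cs ∧ distinct cs

  pairs : {A : Set} → List A → List (A × A)
  pairs []       = []
  pairs (x ∷ xs) = map (x ,_) xs ++ pairs xs

  triples : {A : Set} → List A → List (A × A × A)
  triples []       = []
  triples (x ∷ xs) = map (x ,_) (pairs xs) ++ triples xs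

  vertexObstructions : ∀ {k} → List (Fin N × Fin N) → List (Obstruction k)
  vertexObstructions es = concatMap at (allFin N)
    where
      at : Fin N → List (Obstruction _)
      at x = map (λ (y , z) → matchedPair x y z) (pairs neighbours)
          ++ map (λ (y , z , w) → freeClaw x y z w) (triples neighbours)
        where neighbours = filterᵇ (λ y → not (x == y) ∧ linked es x y) (allFin N)

  module _ {k} (obstructions : List (Obstruction k)) (v u : Fin N) where

    search : Colouring → List (Fin N × Fin N) → Bool
    search c []       = hasColour true c v u
    search c (e ∷ es) = branch true ∧ branch false
      where
        branch : Bool → Bool
        branch β = any (occursIn ((e , β) ∷ c)) obstructions ∨ search ((e , β) ∷ c) es

module _ {N k : ℕ} (es : List (Fin N × Fin N)) (D : Decomposition k (fromEdges es)) where

  private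
    G = fromEdges es

  Free : Fin N → Fin N → Set
  Free x y = Edge G x y × inM D x y ≡ false

  Faithful : Colouring → Set
  Faithful = All (λ ((a , b) , β) → T (linked es a b) × inM D a b ≡ β)

  colouredAs-sound : ∀ {β c x y} → Faithful c → T (colouredAs β c x y) →
                     T (linked es x y) × inM D x y ≡ β
  colouredAs-sound {β} {((a , b) , γ) ∷ c} {x} {y} ((ab , ab≡γ) ∷ fc) h with joins (a , b) x y in j
  ... | false = colouredAs-sound fc h
  ... | true with joins-sound {a = a} {b = b} {x = x} {y = y} (Equivalence.from T-≡ j)
  ...   | inj₁ (refl , refl) = ab , trans ab≡γ (toWitness h)
  ...   | inj₂ (refl , refl) =
    subst T (linked-sym es a b) ab , trans (inM-sym D b a) (trans ab≡γ (toWitness h))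

  hasColour-sound : ∀ {β c x y} → Faithful c → T (hasColour β c x y) → Edge G x y × inM D x y ≡ β
  hasColour-sound fc h =
    let x≢y , xy = Equivalence.to T-∧ h
        linked-xy , colour = colouredAs-sound fc xy
    in edge-intro es x≢y linked-xy , colour

  distinct-sound : ∀ {m} (cs : Vec (Fin N) m) → T (distinct cs) → Injective _≡_ _≡_ (lookup cs)
  distinct-sound cs h {i} {j} = toWitness h i j

  freeWalk-sound : ∀ {c m} → Faithful c → (cs : Vec (Fin N) (suc m)) → T (freeWalk c cs) →
                   ∀ i → Free (lookup cs (inject₁ i)) (lookup cs (suc i))
  freeWalk-sound fc (x ∷ y ∷ cs) h zero    = hasColour-sound fc (proj₁ (Equivalence.to T-∧ h))
  freeWalk-sound fc (x ∷ y ∷ cs) h (suc i) = freeWalk-sound fc (y ∷ cs) (proj₂ (Equivalence.to T-∧ h)) i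

  freePathOf : ∀ {c m} → Faithful c → (cs : Vec (Fin N) (suc m)) →
               T (freeWalk c cs) → T (distinct cs) → PathOfLength Free m
  freePathOf fc cs walk ds = record
    { vtx = lookup cs ; inj = distinct-sound cs ds ; step = freeWalk-sound fc cs walk }

  occursIn-impossible : ∀ {c} → Faithful c → (o : Obstruction k) → ¬ T (occursIn c o)
  occursIn-impossible fc (matchedPair x y z) h
    with xy , h₁ ← Equivalence.to T-∧ h
    with xz , ds ← Equivalence.to T-∧ h₁
    with () ← distinct-sound (y ∷ z ∷ []) ds {zero} {suc zero}
      (matching D x y z (proj₁ (hasColour-sound fc xy)) (proj₁ (hasColour-sound fc xz))
                        (proj₂ (hasColour-sound fc xy)) (proj₂ (hasColour-sound fc xz)))
  occursIn-impossible fc (freeClaw x y z w) h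
    with xy , h₁ ← Equivalence.to T-∧ h
    with xz , h₂ ← Equivalence.to T-∧ h₁
    with xw , ds ← Equivalence.to T-∧ h₂
    with proj₁ (proj₂ (forest D)) x y z w (hasColour-sound fc xy) (hasColour-sound fc xz) (hasColour-sound fc xw)
  ... | inj₁ y≡z        with () ← distinct-sound (y ∷ z ∷ w ∷ []) ds {zero} {suc zero} y≡z
  ... | inj₂ (inj₁ y≡w) with () ← distinct-sound (y ∷ z ∷ w ∷ []) ds {zero} {suc (suc zero)} y≡w
  ... | inj₂ (inj₂ z≡w) with () ← distinct-sound (y ∷ z ∷ w ∷ []) ds {suc zero} {suc (suc zero)} z≡w
  occursIn-impossible fc (freeCycle cs) h
    with walk , h₁ ← Equivalence.to T-∧ h
    with closing , ds ← Equivalence.to T-∧ h₁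
    = proj₁ (forest D) _ record
        { len≥ = s≤s (s≤s z≤n) ; path = freePathOf fc cs walk ds ; close = hasColour-sound fc closing }
  occursIn-impossible fc (freePath cs) h
    with walk , ds ← Equivalence.to T-∧ h
    = proj₂ (proj₂ (forest D)) (freePathOf fc cs walk ds)

  search-sound : ∀ {obstructions : List (Obstruction k)} {v u} c todo → Faithful c →
                 All (λ (a , b) → T (linked es a b)) todo →
                 T (search obstructions v u c todo) → inM D v u ≡ true
  search-sound c [] fc [] h = proj₂ (hasColour-sound fc h)
  search-sound {obstructions} c ((a , b) ∷ todo) fc (ab ∷ linked-todo) h =
    case Equivalence.to T-∨ (branch (inM D a b)) of λ where
      (inj₁ occurs) → let o , o-occurs = satisfied (any⁻ _ obstructions occurs)
                      in ⊥-elim (occursIn-impossible fc′ o o-occurs)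
      (inj₂ rest)   → search-sound _ todo fc′ linked-todo rest
    where
      fc′ = (ab , refl) ∷ fc
      branch : ∀ β → T (any (occursIn (((a , b) , β) ∷ c)) obstructions ∨
                        search obstructions _ _ (((a , b) , β) ∷ c) todo)
      branch true  = proj₁ (Equivalence.to T-∧ h)
      branch false = proj₂ (Equivalence.to T-∧ h)

  forced : ∀ {obstructions : List (Obstruction k)} {v u} →
           T (search obstructions v u [] es) → inM D v u ≡ true
  forced = search-sound [] es [] (listed-linked es)

onSegment? : ∀ p q r → Dec (OnSegment p q r)
onSegment? (px , py) (qx , qy) (rx , ry) =
  (orient (px , py) (qx , qy) (rx , ry) ℤ.≟ 0ℤ)
    ×-dec ((px ⊓ qx) ℤ.≤? rx) ×-dec (rx ℤ.≤? (px ⊔ qx))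
    ×-dec ((py ⊓ qy) ℤ.≤? ry) ×-dec (ry ℤ.≤? (py ⊔ qy))

properCross? : ∀ a b c d → Dec (ProperCross a b c d)
properCross? a b c d =
  ((orient a b c ℤ.* orient a b d) ℤ.<? 0ℤ) ×-dec ((orient c d a ℤ.* orient c d b) ℤ.<? 0ℤ)

module _ {N : ℕ} (es : List (Fin N × Fin N)) (pos : Fin N → Point) where

  Avoids : Fin N → Fin N → Set
  Avoids x y = ∀ z → z ≢ x → z ≢ y → ¬ OnSegment (pos x) (pos y) (pos z)

  Uncrossed : Fin N → Fin N → Fin N → Fin N → Set
  Uncrossed a b c d = a ≢ c → a ≢ d → b ≢ c → b ≢ d → ¬ ProperCross (pos a) (pos b) (pos c) (pos d)

  Crossfree : Fin N → Fin N → Set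
  Crossfree a b = All (BothWays (Uncrossed a b)) es

  straightLineDrawing : (∀ x y → pos x ≡ pos y → x ≡ y) → All (BothWays Avoids) es →
                        All (BothWays Crossfree) es → StraightLineDrawing (fromEdges es)
  straightLineDrawing injective avoiding crossfree = record
    { pos            = pos
    ; pos-inj        = injective _ _
    ; noVertexOnEdge = λ x y z xy → edgewise Avoids avoiding (edge-linked es xy) z
    ; noCrossing     = λ a b c d ab cd →
        edgewise (Uncrossed a b) (edgewise Crossfree crossfree (edge-linked es ab)) (edge-linked es cd)
    }

  Drawable : Set
  Drawable = (∀ x y → pos x ≡ pos y → x ≡ y) × All (BothWays Avoids) es × All (BothWays Crossfree) es

  drawable? : Dec Drawable
  drawable? = injective? ×-dec All.all? (bothWays? avoids?) es ×-dec All.all? (bothWays? crossfree?) es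
    where
      injective? = all? λ x → all? λ y → ≡-dec ℤ._≟_ ℤ._≟_ (pos x) (pos y) →-dec (x ≟ y)
      avoids? : ∀ x y → Dec (Avoids x y)
      avoids? x y = all? λ z → ¬? (z ≟ x) →-dec (¬? (z ≟ y) →-dec
                    ¬? (onSegment? (pos x) (pos y) (pos z)))
      uncrossed? : ∀ a b c d → Dec (Uncrossed a b c d)
      uncrossed? a b c d = ¬? (a ≟ c) →-dec (¬? (a ≟ d) →-dec (¬? (b ≟ c) →-dec (¬? (b ≟ d) →-dec
                           ¬? (properCross? (pos a) (pos b) (pos c) (pos d)))))
      crossfree? : ∀ a b → Dec (Crossfree a b)
      crossfree? a b = All.all? (bothWays? (uncrossed? a b)) es

PlanarForcer : ℕ → Set
PlanarForcer k = Σ Graph λ G → Σ (Fin (n G)) λ v → IsForcer k G v × Planar G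

-- The witness decomposition matches x with y when each is the partner of the other; every other
-- edge must join consecutively numbered vertices of one block, and two vertices of a block differ
-- by at most width in number.
record Gadget (N : ℕ) : Set where
  field
    edges    : List (Fin N × Fin N)
    leaf     : Fin N
    stem     : Fin N
    partner  : Fin N → Fin N
    block    : Fin N → ℕ
    width    : ℕ
    position : Fin N → Point

module Certify {N : ℕ} (g : Gadget N) where
  open Gadget g

  graph : Graph
  graph = fromEdges edges

  Pendant : Set
  Pendant = Edge graph leaf stem × (∀ w → Edge graph leaf w → w ≡ stem)

  Consecutive : Fin N → Fin N → Set
  Consecutive x y = toℕ y ≡ suc (toℕ x) ⊎ toℕ x ≡ suc (toℕ y)

  Tame : Fin N → Fin N → Set
  Tame x y = partnered graph partner x y ≡ true ⊎ Consecutive x y × block x ≡ block y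

  Narrow : Set
  Narrow = ∀ x y → block x ≡ block y → toℕ y ≤ toℕ x + width

  witness : ∀ {k} → width ≤ k → All (BothWays Tame) edges → Narrow → Decomposition k graph
  witness w≤k tame narrow = partnerDecomposition graph partner
    (linearForest toℕ toℕ-injective (proj₁ ∘ tame-unpartnered)
                  block (proj₂ ∘ tame-unpartnered) width narrow w≤k)
    where
      open ConsecutiveLabelling (Unpartnered graph partner) using (linearForest)
      tame-unpartnered : ∀ {x y} → Unpartnered graph partner x y → Consecutive x y × block x ≡ block y
      tame-unpartnered (xy , unpartnered) with edgewise Tame tame (edge-linked edges xy)
      ... | inj₁ partnered with () ← trans (sym partnered) unpartnered
      ... | inj₂ consecutive = consecutive

  Checked : Set
  Checked = Pendant × All (BothWays Tame) edges × Narrow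
          × Drawable edges position

  checked? : Dec Checked
  checked? = pendant? ×-dec All.all? (bothWays? tame?) edges ×-dec narrow?
           ×-dec drawable? edges position
    where
      pendant? = (adj graph leaf stem Bool.≟ true)
           ×-dec all? λ w → (adj graph leaf w Bool.≟ true) →-dec (w ≟ stem)
      tame? : ∀ x y → Dec (Tame x y)
      tame? x y = (partnered graph partner x y Bool.≟ true)
        ⊎-dec ((toℕ y ℕ.≟ suc (toℕ x)) ⊎-dec (toℕ x ℕ.≟ suc (toℕ y))) ×-dec (block x ℕ.≟ block y)
      narrow? = all? λ x → all? λ y → (block x ℕ.≟ block y) →-dec (toℕ y ℕ.≤? toℕ x + width)

  checked-forcer : ∀ {k} → width ≤ k → (obstructions : List (Obstruction k)) →
                   Checked → T (search obstructions leaf stem [] edges) → PlanarForcer k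
  checked-forcer w≤k obstructions
    ((leaf-stem , only-stem) , tame , narrow , injective , avoiding , crossfree) forcing =
    graph , leaf , ((stem , leaf-stem , only-stem) , witness w≤k tame narrow , leaf-matched) ,
    straightLineDrawing edges position injective avoiding crossfree
    where
      leaf-matched : ∀ D w → Edge graph leaf w → inM D leaf w ≡ true
      leaf-matched D w leaf-w rewrite only-stem w leaf-w = forced edges D {obstructions} forcing

  forcer : ∀ {k} → width ≤ k → (obstructions : List (Obstruction k)) →
           True checked? → T (search obstructions leaf stem [] edges) → PlanarForcer k
  forcer w≤k obstructions ok = checked-forcer w≤k obstructions (toWitness ok)

-- Each obstruction list below consists of the vertex obstructions, all cycles and all paths with
-- k + 1 edges of the gadget.

gadget₃ : Gadget 8
gadget₃ = record
  { edges    = (0 , 1) ∷ (1 , 2) ∷ (2 , 3) ∷ (2 , 4) ∷ (3 , 6) ∷ (5 , 6) ∷ (6 , 7) ∷ (3 , 4) ∷ []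
  ; leaf     = 0
  ; stem     = 1
  ; partner  = lookup (1 ∷ 0 ∷ 4 ∷ 6 ∷ 2 ∷ 5 ∷ 3 ∷ 7 ∷ [])
  ; block    = lookup (0 ∷ 1 ∷ 1 ∷ 1 ∷ 1 ∷ 2 ∷ 2 ∷ 2 ∷ [])
  ; width    = 3
  ; position = lookup ((3 , 3) ∷ (4 , 1) ∷ (3 , 0) ∷ (2 , 1) ∷ (2 , 4) ∷ (1 , 3) ∷ (1 , 2)
                       ∷ (0 , 0) ∷ [])
  }

obstructions₃ : List (Obstruction 3)
obstructions₃ = vertexObstructions (Gadget.edges gadget₃)
  ++ freeCycle (2 ∷ 3 ∷ 4 ∷ []) ∷ freePath (0 ∷ 1 ∷ 2 ∷ 3 ∷ 4 ∷ [])
  ∷ freePath (0 ∷ 1 ∷ 2 ∷ 3 ∷ 6 ∷ []) ∷ freePath (0 ∷ 1 ∷ 2 ∷ 4 ∷ 3 ∷ [])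
  ∷ freePath (1 ∷ 2 ∷ 3 ∷ 6 ∷ 5 ∷ []) ∷ freePath (1 ∷ 2 ∷ 3 ∷ 6 ∷ 7 ∷ [])
  ∷ freePath (1 ∷ 2 ∷ 4 ∷ 3 ∷ 6 ∷ []) ∷ freePath (2 ∷ 4 ∷ 3 ∷ 6 ∷ 5 ∷ [])
  ∷ freePath (2 ∷ 4 ∷ 3 ∷ 6 ∷ 7 ∷ []) ∷ freePath (4 ∷ 2 ∷ 3 ∷ 6 ∷ 5 ∷ [])
  ∷ freePath (4 ∷ 2 ∷ 3 ∷ 6 ∷ 7 ∷ []) ∷ []

gadget₄ : Gadget 6
gadget₄ = record
  { edges    = (0 , 3) ∷ (2 , 3) ∷ (3 , 4) ∷ (2 , 4) ∷ (1 , 2) ∷ (4 , 5) ∷ (1 , 5) ∷ []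
  ; leaf     = 0
  ; stem     = 3
  ; partner  = lookup (3 ∷ 5 ∷ 4 ∷ 0 ∷ 2 ∷ 1 ∷ [])
  ; block    = lookup (0 ∷ 1 ∷ 1 ∷ 1 ∷ 1 ∷ 1 ∷ [])
  ; width    = 4
  ; position = lookup ((1 , 0) ∷ (4 , 3) ∷ (0 , 4) ∷ (0 , 3) ∷ (1 , 2) ∷ (2 , 3) ∷ [])
  }

obstructions₄ : List (Obstruction 4)
obstructions₄ = vertexObstructions (Gadget.edges gadget₄)
  ++ freeCycle (2 ∷ 3 ∷ 4 ∷ []) ∷ freeCycle (1 ∷ 2 ∷ 4 ∷ 5 ∷ [])
  ∷ freeCycle (1 ∷ 2 ∷ 3 ∷ 4 ∷ 5 ∷ []) ∷ freePath (0 ∷ 3 ∷ 2 ∷ 1 ∷ 5 ∷ 4 ∷ [])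
  ∷ freePath (0 ∷ 3 ∷ 2 ∷ 4 ∷ 5 ∷ 1 ∷ []) ∷ freePath (0 ∷ 3 ∷ 4 ∷ 2 ∷ 1 ∷ 5 ∷ [])
  ∷ freePath (0 ∷ 3 ∷ 4 ∷ 5 ∷ 1 ∷ 2 ∷ []) ∷ []

gadget₅ : Gadget 7
gadget₅ = record
  { edges    = (0 , 1) ∷ (1 , 2) ∷ (2 , 4) ∷ (2 , 3) ∷ (3 , 4) ∷ (4 , 5) ∷ (3 , 5) ∷ (5 , 6) ∷ []
  ; leaf     = 0
  ; stem     = 1
  ; partner  = lookup (1 ∷ 0 ∷ 4 ∷ 5 ∷ 2 ∷ 3 ∷ 6 ∷ [])
  ; block    = lookup (0 ∷ 1 ∷ 1 ∷ 1 ∷ 1 ∷ 1 ∷ 1 ∷ [])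
  ; width    = 5
  ; position = lookup ((0 , 0) ∷ (3 , 4) ∷ (4 , 2) ∷ (3 , 3) ∷ (4 , 1) ∷ (3 , 0) ∷ (2 , 1) ∷ [])
  }

obstructions₅ : List (Obstruction 5)
obstructions₅ = vertexObstructions (Gadget.edges gadget₅)
  ++ freeCycle (2 ∷ 3 ∷ 4 ∷ []) ∷ freeCycle (3 ∷ 4 ∷ 5 ∷ []) ∷ freeCycle (2 ∷ 3 ∷ 5 ∷ 4 ∷ [])
  ∷ freePath (0 ∷ 1 ∷ 2 ∷ 3 ∷ 4 ∷ 5 ∷ 6 ∷ []) ∷ freePath (0 ∷ 1 ∷ 2 ∷ 4 ∷ 3 ∷ 5 ∷ 6 ∷ []) ∷ []

gadget₆ : Gadget 8
gadget₆ = record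
  { edges    = (0 , 4) ∷ (3 , 4) ∷ (4 , 5) ∷ (3 , 5) ∷ (2 , 3) ∷ (5 , 6) ∷ (2 , 6) ∷ (1 , 2)
               ∷ (6 , 7) ∷ (1 , 7) ∷ []
  ; leaf     = 0
  ; stem     = 4
  ; partner  = lookup (4 ∷ 7 ∷ 6 ∷ 5 ∷ 0 ∷ 3 ∷ 2 ∷ 1 ∷ [])
  ; block    = lookup (0 ∷ 1 ∷ 1 ∷ 1 ∷ 1 ∷ 1 ∷ 1 ∷ 1 ∷ [])
  ; width    = 6
  ; position = lookup ((0 , 3) ∷ (0 , 0) ∷ (2 , 1) ∷ (2 , 2) ∷ (4 , 3) ∷ (4 , 0) ∷ (3 , 0)
                       ∷ (2 , 0) ∷ [])
  }

obstructions₆ : List (Obstruction 6)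
obstructions₆ = vertexObstructions (Gadget.edges gadget₆)
  ++ freeCycle (3 ∷ 4 ∷ 5 ∷ []) ∷ freeCycle (1 ∷ 2 ∷ 6 ∷ 7 ∷ [])
  ∷ freeCycle (2 ∷ 3 ∷ 5 ∷ 6 ∷ []) ∷ freeCycle (2 ∷ 3 ∷ 4 ∷ 5 ∷ 6 ∷ [])
  ∷ freeCycle (1 ∷ 2 ∷ 3 ∷ 5 ∷ 6 ∷ 7 ∷ []) ∷ freeCycle (1 ∷ 2 ∷ 3 ∷ 4 ∷ 5 ∷ 6 ∷ 7 ∷ [])
  ∷ freePath (0 ∷ 4 ∷ 3 ∷ 2 ∷ 1 ∷ 7 ∷ 6 ∷ 5 ∷ [])
  ∷ freePath (0 ∷ 4 ∷ 3 ∷ 5 ∷ 6 ∷ 2 ∷ 1 ∷ 7 ∷ [])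
  ∷ freePath (0 ∷ 4 ∷ 3 ∷ 5 ∷ 6 ∷ 7 ∷ 1 ∷ 2 ∷ [])
  ∷ freePath (0 ∷ 4 ∷ 5 ∷ 3 ∷ 2 ∷ 1 ∷ 7 ∷ 6 ∷ [])
  ∷ freePath (0 ∷ 4 ∷ 5 ∷ 3 ∷ 2 ∷ 6 ∷ 7 ∷ 1 ∷ [])
  ∷ freePath (0 ∷ 4 ∷ 5 ∷ 6 ∷ 7 ∷ 1 ∷ 2 ∷ 3 ∷ []) ∷ []

gadget₇ : Gadget 9
gadget₇ = record
  { edges    = (0 , 2) ∷ (2 , 3) ∷ (1 , 2) ∷ (3 , 4) ∷ (1 , 3) ∷ (4 , 6) ∷ (4 , 5) ∷ (5 , 6)
               ∷ (6 , 7) ∷ (5 , 7) ∷ (7 , 8) ∷ []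
  ; leaf     = 0
  ; stem     = 2
  ; partner  = lookup (2 ∷ 3 ∷ 0 ∷ 1 ∷ 6 ∷ 7 ∷ 4 ∷ 5 ∷ 8 ∷ [])
  ; block    = lookup (0 ∷ 1 ∷ 1 ∷ 1 ∷ 1 ∷ 1 ∷ 1 ∷ 1 ∷ 1 ∷ [])
  ; width    = 7
  ; position = lookup ((1 , 4) ∷ (2 , 2) ∷ (4 , 2) ∷ (2 , 1) ∷ (1 , 0) ∷ (1 , 1) ∷ (2 , 3)
                       ∷ (1 , 2) ∷ (0 , 1) ∷ [])
  }

obstructions₇ : List (Obstruction 7)
obstructions₇ = vertexObstructions (Gadget.edges gadget₇)
  ++ freeCycle (1 ∷ 2 ∷ 3 ∷ []) ∷ freeCycle (4 ∷ 5 ∷ 6 ∷ []) ∷ freeCycle (5 ∷ 6 ∷ 7 ∷ [])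
  ∷ freeCycle (4 ∷ 5 ∷ 7 ∷ 6 ∷ []) ∷ freePath (0 ∷ 2 ∷ 1 ∷ 3 ∷ 4 ∷ 5 ∷ 6 ∷ 7 ∷ 8 ∷ [])
  ∷ freePath (0 ∷ 2 ∷ 1 ∷ 3 ∷ 4 ∷ 6 ∷ 5 ∷ 7 ∷ 8 ∷ []) ∷ []

gadget₈ : Gadget 10
gadget₈ = record
  { edges    = (0 , 5) ∷ (4 , 5) ∷ (2 , 4) ∷ (3 , 4) ∷ (1 , 2) ∷ (1 , 3) ∷ (2 , 3) ∷ (5 , 6)
               ∷ (6 , 8) ∷ (6 , 7) ∷ (8 , 9) ∷ (7 , 9) ∷ (7 , 8) ∷ []
  ; leaf     = 0
  ; stem     = 5
  ; partner  = lookup (5 ∷ 3 ∷ 4 ∷ 1 ∷ 2 ∷ 0 ∷ 8 ∷ 9 ∷ 6 ∷ 7 ∷ [])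
  ; block    = lookup (0 ∷ 1 ∷ 1 ∷ 1 ∷ 1 ∷ 1 ∷ 1 ∷ 1 ∷ 1 ∷ 1 ∷ [])
  ; width    = 8
  ; position = lookup ((3 , 4) ∷ (4 , 2) ∷ (3 , 3) ∷ (4 , 1) ∷ (3 , 0) ∷ (2 , 1) ∷ (2 , 4)
                       ∷ (1 , 3) ∷ (1 , 2) ∷ (0 , 0) ∷ [])
  }

obstructions₈ : ∀ {k} → List (Obstruction k)
obstructions₈ = vertexObstructions (Gadget.edges gadget₈)
  ++ freeCycle (1 ∷ 2 ∷ 3 ∷ []) ∷ freeCycle (2 ∷ 3 ∷ 4 ∷ []) ∷ freeCycle (6 ∷ 7 ∷ 8 ∷ [])
  ∷ freeCycle (7 ∷ 8 ∷ 9 ∷ []) ∷ freeCycle (1 ∷ 2 ∷ 4 ∷ 3 ∷ [])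
  ∷ freeCycle (6 ∷ 7 ∷ 9 ∷ 8 ∷ []) ∷ []

proposition2p4 : (k : ℕ) → 3 ≤ k →
    Σ Graph (λ G → Σ (Fin (n G)) (λ v → IsForcer k G v × Planar G))
proposition2p4 1 (s≤s ())
proposition2p4 2 (s≤s (s≤s ()))
proposition2p4 3 _ = Certify.forcer gadget₃ ≤-refl obstructions₃ _ _
proposition2p4 4 _ = Certify.forcer gadget₄ ≤-refl obstructions₄ _ _
proposition2p4 5 _ = Certify.forcer gadget₅ ≤-refl obstructions₅ _ _
proposition2p4 6 _ = Certify.forcer gadget₆ ≤-refl obstructions₆ _ _
proposition2p4 7 _ = Certify.forcer gadget₇ ≤-refl obstructions₇ _ _
proposition2p4 (suc (suc (suc (suc (suc (suc (suc (suc k)))))))) _ =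
  Certify.forcer gadget₈ (m≤m+n 8 k) obstructions₈ _ _
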